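{- For every $\kappa\in(0,1]$ and every finite ground set $V$, there exists a nonnegative monotone submodular function $f:2^V\to\mathbb{R}$ with $f(\emptyset)=0$ and total curvature $\kappa_f=\kappa$ such that for every modular upper bound $\hat f(X)=\sum_{j\in X}w(j)$ of $f$ (i.e., $w\in\mathbb{R}^V$ with $\hat f(X)\ge f(X)$ for all $X\subseteq V$) and every nonempty $X\subseteq V$, $$\hat f(X)\ge\frac{|X|}{1+(|X|-1)(1-\kappa)}f(X).$$
   Context: For $S\subseteq V$, $j\notin S$, $f(j\mid S)=f(S\cup\{j\})-f(S)$; the total curvature is $\kappa_f = 1-\min_{j\in V}\frac{f(j\mid V\setminus\{j\})}{f(\{j\})}$. -}

module Defs where

open import Level using (Level; _⊔_) renaming (suc to lsuc)
open import Data.Nat using (ℕ; zero; suc)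
open import Data.Bool using (true; false)
open import Data.Fin using (Fin)
open import Data.Fin.Subset using (Subset; ⊥; ⁅_⁆; ∁; _∪_; _∩_; _⊆_)
open import Data.Vec using (lookup)
open import Data.Product using (Σ; _×_; ∃)
open import Relation.Nullary using (¬_)
open import Relation.Binary.Structures using (IsTotalOrder)
open import Algebra.Bundles using (CommutativeRing)

-- An ordered field (with a total inverse, 0⁻¹ = 0).  The real numbers ℝ are
-- a model; the theorem is stated for every ordered field, which implies
-- the real-number statement.
record OrderedField (c ℓ₁ ℓ₂ : Level) : Set (lsuc (c ⊔ ℓ₁ ⊔ ℓ₂)) where
  field
    commutativeRing : CommutativeRing c ℓ₁
  open CommutativeRing commutativeRing public
  infix 4 _≤_
  infix 8 _⁻¹
  field
    _≤_          : Carrier → Carrier → Set ℓ₂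
    isTotalOrder : IsTotalOrder _≈_ _≤_
    +-mono-≤     : ∀ {x y} z → x ≤ y → x + z ≤ y + z
    *-nonneg     : ∀ {x y} → 0# ≤ x → 0# ≤ y → 0# ≤ x * y
    0≉1          : ¬ (0# ≈ 1#)
    _⁻¹          : Carrier → Carrier
    ⁻¹-cong      : ∀ {x y} → x ≈ y → x ⁻¹ ≈ y ⁻¹
    *-inverse    : ∀ x → ¬ (x ≈ 0#) → x * x ⁻¹ ≈ 1#
    0⁻¹          : 0# ⁻¹ ≈ 0#

  infix 4 _<_
  _<_ : Carrier → Carrier → Set (ℓ₁ ⊔ ℓ₂)
  x < y = x ≤ y × ¬ (x ≈ y)

  infixl 6 _−_
  _−_ : Carrier → Carrier → Carrier
  x − y = x + (- y)

  infixl 7 _÷_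
  _÷_ : Carrier → Carrier → Carrier
  x ÷ y = x * y ⁻¹

  ι : ℕ → Carrier
  ι zero    = 0#
  ι (suc k) = 1# + ι k

  sumFin : ∀ {n} → (Fin n → Carrier) → Carrier
  sumFin {zero}  g = 0#
  sumFin {suc n} g = g Fin.zero + sumFin (λ j → g (Fin.suc j))

module _ {c ℓ₁ ℓ₂} (F : OrderedField c ℓ₁ ℓ₂) where
  open OrderedField F

  module _ {n : ℕ} (f : Subset n → Carrier) where

    IsNonnegative : Set ℓ₂
    IsNonnegative = ∀ X → 0# ≤ f X

    IsMonotone : Set ℓ₂
    IsMonotone = ∀ {A B} → A ⊆ B → f A ≤ f B

    IsSubmodular : Set ℓ₂
    IsSubmodular = ∀ A B → f (A ∪ B) + f (A ∩ B) ≤ f A + f B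

    marginal : Fin n → Subset n → Carrier
    marginal j S = f (S ∪ ⁅ j ⁆) − f S

    curvatureRatio : Fin n → Carrier
    curvatureRatio j = marginal j (∁ ⁅ j ⁆) ÷ f ⁅ j ⁆

    -- κ_f = κ, i.e. 1 − min_j curvatureRatio j = κ, with the ratios
    -- well defined (f({j}) ≠ 0).  "min_j r j = m" is unfolded as: m is a
    -- lower bound of all r j and is attained.
    HasTotalCurvature : Carrier → Set (ℓ₁ ⊔ ℓ₂)
    HasTotalCurvature κ =
      (∀ j → ¬ (f ⁅ j ⁆ ≈ 0#)) ×
      (∀ j → 1# − κ ≤ curvatureRatio j) ×
      ∃ (λ j → curvatureRatio j ≈ 1# − κ)

  modular : ∀ {n} → (Fin n → Carrier) → Subset n → Carrier
  modular w X = sumFin (λ j → select (lookup X j) (w j))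
    where
    select : _ → Carrier → Carrier
    select true  x = x
    select false x = 0#

  IsModularUpperBound : ∀ {n} → (Subset n → Carrier) → (Fin n → Carrier) → Set ℓ₂
  IsModularUpperBound f w = ∀ X → f X ≤ modular w X

module Submission where

open import Defs
open import Data.Nat using (ℕ; _≤_)
open import Data.Product using (Σ-syntax; _×_)
open import Data.Fin using (Fin)
open import Data.Fin.Subset using (Subset; ⊥; ∣_∣; Nonempty)

import Data.Nat as N
open import Data.Nat using (zero; suc; z≤n; s≤s)
import Data.Nat.Properties as NP
open import Data.Product using (_,_; proj₁)
open import Data.Sum using (inj₁; inj₂)
open import Data.Vec using (_∷_; [])
open import Data.Fin.Subset using (inside; outside; _∪_; _∩_; _⊆_; ⁅_⁆; ∁; _∈_)
open import Data.Fin.Subset.Properties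
  using ( ∣⊥∣≡0; ∣⊤∣≡n; ∣⁅x⁆∣≡1; ∣∁p∣≡n∸∣p∣; p⊆q⇒∣p∣≤∣q∣; ∣p∩q∣≤∣p∣; ∣p∩q∣≤∣q∣
        ; ∪-inverseˡ; x∈⁅y⁆⇒x≡y )
open import Data.Maybe using (nothing)
open import Relation.Nullary using (¬_)
open import Relation.Binary.Bundles using (Poset)
open import Relation.Binary.Structures using (IsTotalOrder)
open import Relation.Binary.PropositionalEquality as ≡ using (_≡_)

-- The extremal function is
--
--     f(X) = κ·[X ≠ ∅] + (1 − κ)·|X| ,
--
-- a function of |X| alone.  It is a conic combination (weights κ and 1 − κ,
-- both ≥ 0) of two monotone submodular functions: the cardinality |X|,
-- which is modular, and the nonemptiness indicator sgn |X|, whose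
-- submodularity is an inequality between natural numbers.  Singletons have
-- value 1 and the marginal of any element over the rest of the ground set is
-- 1 − κ, so every curvature ratio equals 1 − κ and κ_f = κ.  A modular upper
-- bound w satisfies w(j) ≥ f({j}) = 1, hence f̂(X) ≥ |X|, while for |X| = k ≥ 1
-- we have f(X) = 1 + (k − 1)(1 − κ), so the coefficient in the claimed bound
-- multiplied by f(X) is exactly |X|.

∣∪∣+∣∩∣≡∣∣+∣∣ : ∀ {n} (A B : Subset n) → ∣ A ∪ B ∣ N.+ ∣ A ∩ B ∣ ≡ ∣ A ∣ N.+ ∣ B ∣
∣∪∣+∣∩∣≡∣∣+∣∣ []            []            = ≡.refl
∣∪∣+∣∩∣≡∣∣+∣∣ (inside  ∷ A) (inside  ∷ B) = ≡.cong suc (≡.trans (NP.+-suc _ _)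
  (≡.trans (≡.cong suc (∣∪∣+∣∩∣≡∣∣+∣∣ A B)) (≡.sym (NP.+-suc _ _))))
∣∪∣+∣∩∣≡∣∣+∣∣ (inside  ∷ A) (outside ∷ B) = ≡.cong suc (∣∪∣+∣∩∣≡∣∣+∣∣ A B)
∣∪∣+∣∩∣≡∣∣+∣∣ (outside ∷ A) (inside  ∷ B) =
  ≡.trans (≡.cong suc (∣∪∣+∣∩∣≡∣∣+∣∣ A B)) (≡.sym (NP.+-suc _ _))
∣∪∣+∣∩∣≡∣∣+∣∣ (outside ∷ A) (outside ∷ B) = ∣∪∣+∣∩∣≡∣∣+∣∣ A B

nonempty⇒1≤∣p∣ : ∀ {n} {p : Subset n} → Nonempty p → 1 ≤ ∣ p ∣
nonempty⇒1≤∣p∣ {p = p} (x , x∈p) = ≡.subst (_≤ ∣ p ∣) (∣⁅x⁆∣≡1 x) (p⊆q⇒∣p∣≤∣q∣ ⁅x⁆⊆p)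
  where
  ⁅x⁆⊆p : ⁅ x ⁆ ⊆ p
  ⁅x⁆⊆p y∈⁅x⁆ = ≡.subst (_∈ p) (≡.sym (x∈⁅y⁆⇒x≡y x y∈⁅x⁆)) x∈p

-- The sign of a natural number; sgn ∣ X ∣ is the indicator of X ≠ ∅.
sgn : ℕ → ℕ
sgn zero    = 0
sgn (suc _) = 1

sgn≤1 : ∀ m → sgn m ≤ 1
sgn≤1 zero    = z≤n
sgn≤1 (suc m) = s≤s z≤n

sgn-mono : ∀ {m n} → m ≤ n → sgn m ≤ sgn n
sgn-mono z≤n     = z≤n
sgn-mono (s≤s _) = s≤s z≤n

-- The numeric content of the submodularity of X ↦ [X ≠ ∅]: if u + i = a + b
-- with i ≤ a, b (cardinalities of A ∪ B, A ∩ B, A, B), then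
-- sgn u + sgn i ≤ sgn a + sgn b.  When a or b vanishes, u equals the other.
sgn-submodular : ∀ u i a b → i ≤ a → i ≤ b → u N.+ i ≡ a N.+ b →
                 sgn u N.+ sgn i ≤ sgn a N.+ sgn b
sgn-submodular u zero    zero    b       _  _  u+0≡b =
  NP.≤-reflexive (≡.trans (NP.+-identityʳ (sgn u))
                          (≡.cong sgn (≡.trans (≡.sym (NP.+-identityʳ u)) u+0≡b)))
sgn-submodular u zero    (suc a) zero    _  _  _ = NP.+-monoˡ-≤ 0 (sgn≤1 u)
sgn-submodular u i       (suc a) (suc b) _  _  _ = NP.+-mono-≤ (sgn≤1 u) (sgn≤1 i)
sgn-submodular u (suc i) (suc a) zero    _  () _

module OrderedFieldProperties {c ℓ₁ ℓ₂} (F : OrderedField c ℓ₁ ℓ₂) where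
  open OrderedField F renaming (_≤_ to _≤F_)
  module ≤ = IsTotalOrder isTotalOrder
  open import Algebra.Properties.Ring ring using (-‿distribˡ-*; -‿distribʳ-*; -‿involutive; x[y-z]≈xy-xz)
  open import Algebra.Properties.Group +-group using (//-rightDividesˡ; //-rightDividesʳ)
  open import Algebra.Solver.Ring.NaturalCoefficients commutativeSemiring (λ _ _ → nothing)

  poset : Poset c ℓ₁ ℓ₂
  poset = record { isPartialOrder = ≤.isPartialOrder }

  open import Relation.Binary.Reasoning.PartialOrder poset

  +-mono-≤₂ : ∀ {a b x y} → a ≤F b → x ≤F y → a + x ≤F b + y
  +-mono-≤₂ {a} {b} {x} {y} a≤b x≤y = begin
    a + x  ≤⟨ +-mono-≤ x a≤b ⟩
    b + x  ≈⟨ +-comm b x ⟩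
    x + b  ≤⟨ +-mono-≤ b x≤y ⟩
    y + b  ≈⟨ +-comm y b ⟩
    b + y  ∎

  -- x ≤ y iff 0 ≤ y − x; this reduces scaling to the axiom *-nonneg.
  x≤y⇒0≤y−x : ∀ {x y} → x ≤F y → 0# ≤F y − x
  x≤y⇒0≤y−x {x} {y} x≤y = begin
    0#     ≈⟨ -‿inverseʳ x ⟨
    x − x  ≤⟨ +-mono-≤ (- x) x≤y ⟩
    y − x  ∎

  0≤y−x⇒x≤y : ∀ {x y} → 0# ≤F y − x → x ≤F y
  0≤y−x⇒x≤y {x} {y} 0≤y−x = begin
    x          ≈⟨ +-identityˡ x ⟨
    0# + x     ≤⟨ +-mono-≤ x 0≤y−x ⟩
    y − x + x  ≈⟨ //-rightDividesˡ x y ⟩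
    y          ∎

  *-monoˡ-≤ : ∀ {k x y} → 0# ≤F k → x ≤F y → k * x ≤F k * y
  *-monoˡ-≤ {k} {x} {y} 0≤k x≤y = 0≤y−x⇒x≤y (begin
    0#               ≤⟨ *-nonneg 0≤k (x≤y⇒0≤y−x x≤y) ⟩
    k * (y − x)      ≈⟨ x[y-z]≈xy-xz k y x ⟩
    k * y − k * x    ∎)

  square-nonneg : ∀ x → 0# ≤F x * x
  square-nonneg x with ≤.total 0# x
  ... | inj₁ 0≤x = *-nonneg 0≤x 0≤x
  ... | inj₂ x≤0 = begin
    0#         ≤⟨ *-nonneg 0≤-x 0≤-x ⟩
    - x * - x  ≈⟨ -‿distribˡ-* x (- x) ⟨
    - (x * - x) ≈⟨ -‿cong (-‿distribʳ-* x x) ⟨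
    - - (x * x) ≈⟨ -‿involutive (x * x) ⟩
    x * x      ∎
    where
    0≤-x : 0# ≤F - x
    0≤-x = begin
      0#      ≤⟨ x≤y⇒0≤y−x x≤0 ⟩
      0# − x  ≈⟨ +-identityˡ (- x) ⟩
      - x     ∎

  0≤1 : 0# ≤F 1#
  0≤1 = ≤.trans (square-nonneg 1#) (≤.reflexive (*-identityˡ 1#))

  1≤x⇒x≉0 : ∀ {x} → 1# ≤F x → ¬ (x ≈ 0#)
  1≤x⇒x≉0 1≤x x≈0 = 0≉1 (≤.antisym 0≤1 (≤.trans 1≤x (≤.reflexive x≈0)))

  ÷-*-cancel : ∀ {x} y → ¬ (x ≈ 0#) → (y ÷ x) * x ≈ y
  ÷-*-cancel {x} y x≉0 = begin-equality
    y * x ⁻¹ * x    ≈⟨ *-assoc y (x ⁻¹) x ⟩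
    y * (x ⁻¹ * x)  ≈⟨ *-congˡ (*-comm (x ⁻¹) x) ⟩
    y * (x * x ⁻¹)  ≈⟨ *-congˡ (*-inverse x x≉0) ⟩
    y * 1#          ≈⟨ *-identityʳ y ⟩
    y               ∎

  1⁻¹≈1 : 1# ⁻¹ ≈ 1#
  1⁻¹≈1 = trans (sym (*-identityˡ (1# ⁻¹))) (*-inverse 1# (λ 1≈0 → 0≉1 (sym 1≈0)))

  ι-+ : ∀ m n → ι (m N.+ n) ≈ ι m + ι n
  ι-+ zero    n = sym (+-identityˡ (ι n))
  ι-+ (suc m) n = trans (+-congˡ (ι-+ m n)) (sym (+-assoc 1# (ι m) (ι n)))

  0≤ι : ∀ k → 0# ≤F ι k
  0≤ι zero    = ≤.refl
  0≤ι (suc k) = ≤.trans (≤.reflexive (sym (+-identityˡ 0#))) (+-mono-≤₂ 0≤1 (0≤ι k))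

  ι-mono : ∀ {m n} → m ≤ n → ι m ≤F ι n
  ι-mono {n = n} z≤n = 0≤ι n
  ι-mono (s≤s m≤n)   = +-mono-≤₂ ≤.refl (ι-mono m≤n)

  ι-+-mono : ∀ a b x y → a N.+ b ≤ x N.+ y → ι a + ι b ≤F ι x + ι y
  ι-+-mono a b x y a+b≤x+y = begin
    ι a + ι b    ≈⟨ ι-+ a b ⟨
    ι (a N.+ b)  ≤⟨ ι-mono a+b≤x+y ⟩
    ι (x N.+ y)  ≈⟨ ι-+ x y ⟩
    ι x + ι y    ∎

  x+y−y≈x : ∀ x y → x + y − y ≈ x
  x+y−y≈x x y = //-rightDividesʳ y x

  x+[y−x]≈y : ∀ x y → x + (y − x) ≈ y
  x+[y−x]≈y x y = trans (+-comm x (y − x)) (//-rightDividesˡ x y)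

  ι-suc−1 : ∀ k → ι (suc k) − 1# ≈ ι k
  ι-suc−1 k = trans (+-congʳ (+-comm 1# (ι k))) (x+y−y≈x (ι k) 1#)

  module _ {n : ℕ} where
    card : Subset n → Carrier
    card X = ι ∣ X ∣

    nonempty : Subset n → Carrier
    nonempty X = ι (sgn ∣ X ∣)

    card-nonneg : IsNonnegative F card
    card-nonneg X = 0≤ι ∣ X ∣

    card-mono : IsMonotone F card
    card-mono A⊆B = ι-mono (p⊆q⇒∣p∣≤∣q∣ A⊆B)

    card-submodular : IsSubmodular F card
    card-submodular A B = ι-+-mono (∣ A ∪ B ∣) (∣ A ∩ B ∣) (∣ A ∣) (∣ B ∣)
      (NP.≤-reflexive (∣∪∣+∣∩∣≡∣∣+∣∣ A B))

    nonempty-nonneg : IsNonnegative F nonempty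
    nonempty-nonneg X = 0≤ι (sgn ∣ X ∣)

    nonempty-mono : IsMonotone F nonempty
    nonempty-mono A⊆B = ι-mono (sgn-mono (p⊆q⇒∣p∣≤∣q∣ A⊆B))

    nonempty-submodular : IsSubmodular F nonempty
    nonempty-submodular A B =
      ι-+-mono (sgn ∣ A ∪ B ∣) (sgn ∣ A ∩ B ∣) (sgn ∣ A ∣) (sgn ∣ B ∣)
        (sgn-submodular (∣ A ∪ B ∣) (∣ A ∩ B ∣) (∣ A ∣) (∣ B ∣)
                        (∣p∩q∣≤∣p∣ A B) (∣p∩q∣≤∣q∣ A B) (∣∪∣+∣∩∣≡∣∣+∣∣ A B))

  module ConicCombination {α β : Carrier} (0≤α : 0# ≤F α) (0≤β : 0# ≤F β) where

    conic-≤ : ∀ {x y x′ y′} → x ≤F y → x′ ≤F y′ → α * x + β * x′ ≤F α * y + β * y′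
    conic-≤ x≤y x′≤y′ = +-mono-≤₂ (*-monoˡ-≤ 0≤α x≤y) (*-monoˡ-≤ 0≤β x′≤y′)

    conic-+ : ∀ x y x′ y′ → (α * x + β * x′) + (α * y + β * y′) ≈ α * (x + y) + β * (x′ + y′)
    conic-+ = solve 6
      (λ a b x y x′ y′ → (a :* x :+ b :* x′) :+ (a :* y :+ b :* y′) := a :* (x :+ y) :+ b :* (x′ :+ y′))
      refl α β

    module _ {n : ℕ} (g h : Subset n → Carrier) where
      conic : Subset n → Carrier
      conic X = α * g X + β * h X

      conic-nonneg : IsNonnegative F g → IsNonnegative F h → IsNonnegative F conic
      conic-nonneg 0≤g 0≤h X = begin
        0#                  ≈⟨ trans (+-cong (zeroʳ α) (zeroʳ β)) (+-identityʳ 0#) ⟨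
        α * 0# + β * 0#     ≤⟨ conic-≤ (0≤g X) (0≤h X) ⟩
        conic X             ∎

      conic-mono : IsMonotone F g → IsMonotone F h → IsMonotone F conic
      conic-mono g-mono h-mono A⊆B = conic-≤ (g-mono A⊆B) (h-mono A⊆B)

      conic-submodular : IsSubmodular F g → IsSubmodular F h → IsSubmodular F conic
      conic-submodular g-sub h-sub A B = begin
        conic (A ∪ B) + conic (A ∩ B)                          ≈⟨ conic-+ _ _ _ _ ⟩
        α * (g (A ∪ B) + g (A ∩ B)) + β * (h (A ∪ B) + h (A ∩ B)) ≤⟨ conic-≤ (g-sub A B) (h-sub A B) ⟩
        α * (g A + g B) + β * (h A + h B)                      ≈⟨ conic-+ _ _ _ _ ⟨
        conic A + conic B                                      ∎

  modular-⊥ : ∀ {n} (w : Fin n → Carrier) → modular F w ⊥ ≈ 0#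
  modular-⊥ {zero}  w = refl
  modular-⊥ {suc n} w = trans (+-identityˡ _) (modular-⊥ (λ i → w (Fin.suc i)))

  modular-⁅⁆ : ∀ {n} (w : Fin n → Carrier) j → modular F w ⁅ j ⁆ ≈ w j
  modular-⁅⁆ w Fin.zero    = trans (+-congˡ (modular-⊥ (λ i → w (Fin.suc i)))) (+-identityʳ _)
  modular-⁅⁆ w (Fin.suc j) = trans (+-identityˡ _) (modular-⁅⁆ (λ i → w (Fin.suc i)) j)

  modular-≥-card : ∀ {n} (w : Fin n → Carrier) → (∀ j → 1# ≤F w j) →
                   ∀ X → ι ∣ X ∣ ≤F modular F w X
  modular-≥-card w 1≤w []            = ≤.refl
  modular-≥-card w 1≤w (inside  ∷ X) =
    +-mono-≤₂ (1≤w Fin.zero) (modular-≥-card (λ i → w (Fin.suc i)) (λ i → 1≤w (Fin.suc i)) X)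
  modular-≥-card w 1≤w (outside ∷ X) = ≤.trans
    (modular-≥-card (λ i → w (Fin.suc i)) (λ i → 1≤w (Fin.suc i)) X)
    (≤.reflexive (sym (+-identityˡ _)))

module Construction {c ℓ₁ ℓ₂} (F : OrderedField c ℓ₁ ℓ₂) where
  open OrderedField F renaming (_≤_ to _≤F_)
  open OrderedFieldProperties F
  open import Relation.Binary.Reasoning.PartialOrder poset
  open import Algebra.Solver.Ring.NaturalCoefficients commutativeSemiring (λ _ _ → nothing)

  module Extremal (κ : Carrier) (0≤κ : 0# ≤F κ) (κ≤1 : κ ≤F 1#) where
    κ̄ : Carrier
    κ̄ = 1# − κ

    0≤κ̄ : 0# ≤F κ̄
    0≤κ̄ = x≤y⇒0≤y−x κ≤1

    open ConicCombination 0≤κ 0≤κ̄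

    f : ∀ {n} → Subset n → Carrier
    f = conic nonempty card

    f-nonneg : ∀ {n} → IsNonnegative F (f {n})
    f-nonneg = conic-nonneg nonempty card nonempty-nonneg card-nonneg

    f-mono : ∀ {n} → IsMonotone F (f {n})
    f-mono = conic-mono nonempty card nonempty-mono card-mono

    f-submodular : ∀ {n} → IsSubmodular F (f {n})
    f-submodular = conic-submodular nonempty card nonempty-submodular card-submodular

    profile : ℕ → Carrier
    profile k = κ * ι (sgn k) + κ̄ * ι k

    f≈profile : ∀ {n} (X : Subset n) {k} → ∣ X ∣ ≡ k → f X ≈ profile k
    f≈profile X ≡.refl = refl

    profile-0 : profile 0 ≈ 0#
    profile-0 = trans (+-cong (zeroʳ κ) (zeroʳ κ̄)) (+-identityʳ 0#)

    profile-suc : ∀ k → profile (suc k) ≈ 1# + κ̄ * ι k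
    profile-suc k = begin-equality
      κ * (1# + 0#) + κ̄ * (1# + ι k)  ≈⟨ solve 3 (λ a b x → a :* (con 1 :+ con 0) :+ b :* (con 1 :+ x) :=
                                                          (a :+ b) :+ b :* x) refl κ κ̄ (ι k) ⟩
      (κ + κ̄) + κ̄ * ι k                ≈⟨ +-congʳ (x+[y−x]≈y κ 1#) ⟩
      1# + κ̄ * ι k                     ∎

    profile-1 : profile 1 ≈ 1#
    profile-1 = trans (profile-suc 0) (trans (+-congˡ (zeroʳ κ̄)) (+-identityʳ 1#))

    profile-step : ∀ m → profile (suc (suc m)) ≈ κ̄ + profile (suc m)
    profile-step m = begin-equality
      profile (suc (suc m))       ≈⟨ profile-suc (suc m) ⟩
      1# + κ̄ * (1# + ι m)         ≈⟨ solve 2 (λ b x → con 1 :+ b :* (con 1 :+ x) := b :+ (con 1 :+ b :* x))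
                                           refl κ̄ (ι m) ⟩
      κ̄ + (1# + κ̄ * ι m)          ≈⟨ +-congˡ (profile-suc m) ⟨
      κ̄ + profile (suc m)         ∎

    f⊥≈0 : ∀ {n} → f (⊥ {n}) ≈ 0#
    f⊥≈0 {n} = trans (f≈profile (⊥ {n}) (∣⊥∣≡0 n)) profile-0

    f⁅j⁆≈1 : ∀ {n} (j : Fin n) → f ⁅ j ⁆ ≈ 1#
    f⁅j⁆≈1 j = trans (f≈profile ⁅ j ⁆ (∣⁅x⁆∣≡1 j)) profile-1

    marginal-complement : ∀ m (j : Fin (suc (suc m))) → marginal F f j (∁ ⁅ j ⁆) ≈ κ̄
    marginal-complement m j = begin-equality
      f (∁ ⁅ j ⁆ ∪ ⁅ j ⁆) − f (∁ ⁅ j ⁆)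
        ≈⟨ +-cong (f≈profile (∁ ⁅ j ⁆ ∪ ⁅ j ⁆) ∣V∣≡2+m) (-‿cong (f≈profile (∁ ⁅ j ⁆) ∣V∖j∣≡1+m)) ⟩
      profile (suc (suc m)) − profile (suc m) ≈⟨ +-congʳ (profile-step m) ⟩
      κ̄ + profile (suc m) − profile (suc m)   ≈⟨ x+y−y≈x κ̄ (profile (suc m)) ⟩
      κ̄                                       ∎
      where
      ∣V∣≡2+m : ∣ ∁ ⁅ j ⁆ ∪ ⁅ j ⁆ ∣ ≡ suc (suc m)
      ∣V∣≡2+m = ≡.trans (≡.cong ∣_∣ (∪-inverseˡ ⁅ j ⁆)) (∣⊤∣≡n (suc (suc m)))
      ∣V∖j∣≡1+m : ∣ ∁ ⁅ j ⁆ ∣ ≡ suc m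
      ∣V∖j∣≡1+m = ≡.trans (∣∁p∣≡n∸∣p∣ ⁅ j ⁆) (≡.cong (suc (suc m) N.∸_) (∣⁅x⁆∣≡1 j))

    curvatureRatio≈κ̄ : ∀ m (j : Fin (suc (suc m))) → curvatureRatio F f j ≈ κ̄
    curvatureRatio≈κ̄ m j =
      trans (*-cong (marginal-complement m j) (trans (⁻¹-cong (f⁅j⁆≈1 j)) 1⁻¹≈1)) (*-identityʳ κ̄)

    f-curvature : ∀ m → HasTotalCurvature F (f {suc (suc m)}) κ
    f-curvature m = (λ j → 1≤x⇒x≉0 (≤.reflexive (sym (f⁅j⁆≈1 j))))
                  , (λ j → ≤.reflexive (sym (curvatureRatio≈κ̄ m j)))
                  , (Fin.zero , curvatureRatio≈κ̄ m Fin.zero)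

    -- For k ≥ 1 the denominator 1 + (k − 1)κ̄ is exactly profile k, so the
    -- coefficient of the bound times f(X) is |X|.
    bound-coefficient : ∀ {k} → 1 ≤ k → (ι k ÷ (1# + (ι k − 1#) * κ̄)) * profile k ≈ ι k
    bound-coefficient {suc k} _ = begin-equality
      (ι (suc k) ÷ (1# + (ι (suc k) − 1#) * κ̄)) * profile (suc k)
        ≈⟨ *-congʳ (*-congˡ (⁻¹-cong denominator≈profile)) ⟩
      (ι (suc k) ÷ profile (suc k)) * profile (suc k)
        ≈⟨ ÷-*-cancel (ι (suc k)) (1≤x⇒x≉0 1≤profile) ⟩
      ι (suc k) ∎
      where
      denominator≈profile : 1# + (ι (suc k) − 1#) * κ̄ ≈ profile (suc k)
      denominator≈profile =
        trans (+-congˡ (trans (*-congʳ (ι-suc−1 k)) (*-comm (ι k) κ̄))) (sym (profile-suc k))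
      1≤profile : 1# ≤F profile (suc k)
      1≤profile = begin
        1#             ≈⟨ +-identityʳ 1# ⟨
        1# + 0#        ≤⟨ +-mono-≤₂ ≤.refl (*-nonneg 0≤κ̄ (0≤ι k)) ⟩
        1# + κ̄ * ι k   ≈⟨ profile-suc k ⟨
        profile (suc k) ∎

    -- A modular upper bound has all weights ≥ f({j}) = 1, hence f̂(X) ≥ |X|.
    modular-bound : ∀ {n} (w : Fin n → Carrier) → IsModularUpperBound F f w →
                    (X : Subset n) → Nonempty X →
                    (ι ∣ X ∣ ÷ (1# + (ι ∣ X ∣ − 1#) * κ̄)) * f X ≤F modular F w X
    modular-bound w f≤f̂ X X≢∅ = begin
      (ι ∣ X ∣ ÷ (1# + (ι ∣ X ∣ − 1#) * κ̄)) * f X  ≈⟨ bound-coefficient (nonempty⇒1≤∣p∣ X≢∅) ⟩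
      ι ∣ X ∣                                       ≤⟨ modular-≥-card w 1≤w X ⟩
      modular F w X                                 ∎
      where
      1≤w : ∀ j → 1# ≤F w j
      1≤w j = begin
        1#                ≈⟨ f⁅j⁆≈1 j ⟨
        f ⁅ j ⁆           ≤⟨ f≤f̂ ⁅ j ⁆ ⟩
        modular F w ⁅ j ⁆ ≈⟨ modular-⁅⁆ w j ⟩
        w j               ∎

lemma4 : ∀ {c ℓ₁ ℓ₂} (F : OrderedField c ℓ₁ ℓ₂) →
    let open OrderedField F renaming (_≤_ to _≤F_) in
    (κ : Carrier) → 0# < κ → κ ≤F 1# →
    (n : ℕ) → 2 ≤ n →
    Σ[ f ∈ (Subset n → Carrier) ]
      ( IsNonnegative F f
      × IsMonotone F f
      × IsSubmodular F f
      × f ⊥ ≈ 0#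
      × HasTotalCurvature F f κ
      × ((w : Fin n → Carrier) → IsModularUpperBound F f w →
         (X : Subset n) → Nonempty X →
         (ι ∣ X ∣ ÷ (1# + (ι ∣ X ∣ − 1#) * (1# − κ))) * f X ≤F modular F w X) )
lemma4 F κ 0<κ κ≤1 (suc (suc m)) (s≤s (s≤s _)) =
  f , f-nonneg , f-mono , f-submodular , f⊥≈0 {suc (suc m)} , f-curvature m , modular-bound
  where open Construction.Extremal F κ (proj₁ 0<κ) κ≤1
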